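{- Let $G=(V,E)$ be a connected hedgegraph with weak partition connectivity $\mathrm{WPC}_G$ and hedgegraph polymatroid $f:2^E\to\mathbb{Z}_{\ge0}$. Then $\mathrm{WPC}_G\le k^*(f)$.
   Context: A hedgegraph $G=(V,E)$ consists of a finite vertex set $V$ and a finite set $E$ of hedges; each hedge is a set of hyperedges (subsets of $V$), the hyperedges within one hedge are pairwise vertex-disjoint, and no hyperedge belongs to two hedges. For $A\subseteq E$, $\#\mathrm{Comps}(V,A)$ is the number of connected components of the hypergraph on $V$ formed by all hyperedges of hedges in $A$; $G$ is connected if $\#\mathrm{Comps}(V,E)=1$; $f(A)=|V|-\#\mathrm{Comps}(V,A)$. For a partition $\mathcal{P}$ of $V$ into nonempty parts and a hedge $e$, $\mathcal{P}(e)$ is the hedgegraph obtained from $(V,\{e\})$ by contracting each part of $\mathcal{P}$ into a single vertex, with $\#\mathrm{Comps}(\mathcal{P}(e))$ components. $\mathrm{WPC}_G=\min_{\mathcal{P}}\left\lfloor\frac{\sum_{e\in E}(|\mathcal{P}|-\#\mathrm{Comps}(\mathcal{P}(e)))}{|\mathcal{P}|-1}\right\rfloor$ (with $0/0=+\infty$). The functional strength is $k^*(f)=\min_{A\subseteq E}\left\lfloor\frac{\sum_{e\in E}(f(A\cup\{e\})-f(A))}{f(E)-f(A)}\right\rfloor$ (with $0/0=+\infty$). -}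

module Defs where

open import Data.Nat using (ℕ; zero; suc; _∸_; _/_; _≤_)
open import Data.Bool using (Bool; true; false; _∧_; _∨_; not; if_then_else_)
open import Data.Fin using (Fin; _<?_)
open import Data.Fin.Properties using () renaming (_≟_ to _≟F_)
open import Data.Fin.Subset using (Subset; ⊤; ⁅_⁆; _∪_; _∩_; Empty)
open import Data.List using (List; []; _∷_; filter; length; concatMap; map; allFin)
open import Data.Bool.ListAction using (any)
open import Data.Nat.ListAction using (sum)
open import Data.List.Membership.Propositional using (_∈_; _∉_)
open import Data.List.Relation.Unary.AllPairs using (AllPairs)
open import Data.Vec using (lookup)
open import Data.Product using (Σ; ∃; _×_; _,_)
open import Function.Definitions using (Surjective)
open import Relation.Binary.PropositionalEquality using (_≡_; _≢_)
open import Relation.Nullary.Decidable using (⌊_⌋)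

adjacent : ∀ {n} → List (Subset n) → Fin n → Fin n → Bool
adjacent hs u w = any (λ h → lookup h u ∧ lookup h w) hs

reach : ∀ {n} → List (Subset n) → ℕ → Fin n → Fin n → Bool
reach hs zero    u v = ⌊ u ≟F v ⌋
reach {n} hs (suc k) u v =
  reach hs k u v ∨ any (λ w → adjacent hs u w ∧ reach hs k w v) (allFin n)

-- u and v in the same connected component (a walk of ≤ n steps suffices)
connectedB : ∀ {n} → List (Subset n) → Fin n → Fin n → Bool
connectedB {n} hs u v = reach hs n u v

-- number of connected components = number of vertices that are the
-- least vertex (in the order of Fin n) of their component
numComps : ∀ n → List (Subset n) → ℕ
numComps n hs =
  length (filter (λ v → not (any (λ w → ⌊ w <? v ⌋ ∧ connectedB hs w v) (allFin n)) ≟B true)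
                 (allFin n))
  where
  open import Data.Bool.Properties using () renaming (_≟_ to _≟B_)

-- Hedgegraphs: V = Fin n, E = Fin m, a hedge is a list of hyperedges.

record Hedgegraph : Set where
  field
    n      : ℕ
    m      : ℕ
    hedge  : Fin m → List (Subset n)
    disjoint : ∀ e → AllPairs (λ h h′ → Empty (h ∩ h′)) (hedge e)
    unique : ∀ e e′ → e ≢ e′ → ∀ {h} → h ∈ hedge e → h ∉ hedge e′

module _ (G : Hedgegraph) where
  open Hedgegraph G

  hyperedgesOf : Subset m → List (Subset n)
  hyperedgesOf A = concatMap hedge (filter (λ e → lookup A e ≟B true) (allFin m))
    where open import Data.Bool.Properties using () renaming (_≟_ to _≟B_)

  #Comps : Subset m → ℕ
  #Comps A = numComps n (hyperedgesOf A)

  Connected : Set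
  Connected = #Comps ⊤ ≡ 1

  f : Subset m → ℕ
  f A = n ∸ #Comps A

-- Extended naturals (for the convention 0/0 = +∞) and minima.

data ℕ∞ : Set where
  fin : ℕ → ℕ∞
  ∞   : ℕ∞

data _≤∞_ : ℕ∞ → ℕ∞ → Set where
  fin≤fin : ∀ {a b} → a ≤ b → fin a ≤∞ fin b
  _≤∞∞    : ∀ x → x ≤∞ ∞

-- ⌊ a / b ⌋, with a/0 = +∞ (in both uses below b = 0 forces a = 0)
floorDiv : ℕ → ℕ → ℕ∞
floorDiv a zero    = ∞
floorDiv a (suc b) = fin (a / suc b)

IsMinimum : ∀ {I : Set} → (I → ℕ∞) → ℕ∞ → Set
IsMinimum {I} val w = (∃ λ i → val i ≡ w) × (∀ i → w ≤∞ val i)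

-- Partitions of Fin n into k nonempty parts, given by a surjective
-- labelling p : Fin n → Fin k (part of v = p v); |P| = k.

record Partition (n : ℕ) : Set where
  field
    k     : ℕ
    part  : Fin n → Fin k
    onto  : Surjective _≡_ _≡_ part

contractEdge : ∀ {n k} → (Fin n → Fin k) → Subset n → Subset k
contractEdge {n} {k} p h =
  Data.Vec.tabulate (λ j → any (λ i → lookup h i ∧ ⌊ p i ≟F j ⌋) (allFin n))

module _ (G : Hedgegraph) where
  open Hedgegraph G

  #CompsContr : Partition n → Fin m → ℕ
  #CompsContr P e = numComps k (map (contractEdge part) (hedge e))
    where open Partition P

  wpcValue : Partition n → ℕ∞
  wpcValue P = floorDiv (sum (map (λ e → k ∸ #CompsContr P e) (allFin m))) (k ∸ 1)
    where open Partition P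

  kValue : Subset m → ℕ∞
  kValue A = floorDiv (sum (map (λ e → f G (A ∪ ⁅ e ⁆) ∸ f G A) (allFin m)))
                      (f G ⊤ ∸ f G A)

  IsWPC : ℕ∞ → Set
  IsWPC = IsMinimum wpcValue

  IsFunctionalStrength : ℕ∞ → Set
  IsFunctionalStrength = IsMinimum kValue

-- Let A attain k*(f) and let P be the partition of V into the components of (V, A),
-- so |P| = #Comps(V, A) and, G being connected, f(E) - f(A) = |P| - 1.  Vertices
-- whose parts are linked in the contraction P(e) are linked in (V, A ∪ {e}), hence
-- #Comps(V, A ∪ {e}) ≤ #Comps(P(e)) and every summand |P| - #Comps(P(e)) of the value
-- of P is at most f(A ∪ {e}) - f(A).  So WPC_G ≤ value of P ≤ k*(f).
module Submission where

open import Defs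
open import Data.Bool using (Bool; true; false; T; _∧_; not)
open import Data.Bool.ListAction using (any)
open import Data.Bool.Properties using (T-∧; T-∨; T-≡; T-not-≡; ∧-comm) renaming (_≟_ to _≟B_)
open import Data.Fin as Fin using (Fin; _<_; _<?_)
open import Data.Fin.Induction using (Acc; acc; <-wellFounded)
open import Data.Fin.Properties using (<-cmp; injective⇒≤) renaming (_≟_ to _≟F_)
open import Data.Fin.Subset using (Subset; ⊤; ⁅_⁆; _∪_) renaming (_∈_ to _∈ₛ_; _⊆_ to _⊆ₛ_)
open import Data.Fin.Subset.Properties using (p⊆p∪q; x∈p∪q⁺; x∈⁅x⁆)
open import Data.List using (List; []; _∷_; length; lookup; filter; allFin; map)
open import Data.List.Membership.Propositional using (_∈_; find; lose)
open import Data.List.Membership.Propositional.Properties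
  using (∈-lookup; ∈-allFin; ∈-filter⁺; ∈-filter⁻; ∈-map⁻; ∈-concatMap⁺; ∈-concatMap⁻)
open import Data.List.Properties using (length-tabulate)
open import Data.List.Relation.Binary.Subset.Propositional using () renaming (_⊆_ to _⊆ᴸ_)
open import Data.List.Relation.Binary.Subset.Propositional.Properties using (Any-resp-⊆)
open import Data.List.Relation.Unary.All as All using ()
open import Data.List.Relation.Unary.All.Properties.Core using (¬Any⇒All¬)
open import Data.List.Relation.Unary.AllPairs using ([]; _∷_)
open import Data.List.Relation.Unary.Any as Any using (here; there; index; any?)
open import Data.List.Relation.Unary.Any.Properties using (lookup-index; any⁺; any⁻)
open import Data.List.Relation.Unary.Unique.Propositional using (Unique)
import Data.List.Relation.Unary.Unique.Propositional.Properties as Unique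
open import Data.Nat as ℕ using (ℕ; zero; suc; _∸_; _≤_; _≤′_; ≤′-refl; ≤′-step; z≤n; s≤s)
open import Data.Nat.DivMod using (/-monoˡ-≤)
open import Data.Nat.ListAction using (sum)
import Data.Nat.Properties as ℕ
open import Data.Product using (Σ; ∃; ∃₂; _×_; _,_; proj₁; proj₂)
open import Data.Sum using (inj₁; inj₂)
import Data.Vec as Vec
open import Data.Vec.Properties using (lookup∘tabulate; []=⇒lookup; lookup⇒[]=)
open import Function using (_∘_; Equivalence)
open import Function.Definitions using (Surjective)
open import Relation.Binary.Construct.Closure.ReflexiveTransitive as Star using (Star; ε; _◅_; _◅◅_)
open import Relation.Binary.Definitions using (tri<; tri≈; tri>)
open import Relation.Binary.PropositionalEquality
open import Relation.Nullary using (¬_; Dec; yes; no; contradiction)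
open import Relation.Nullary.Decidable using (⌊_⌋; toWitness; fromWitness)

open Equivalence using (to; from)

lookup-injective : ∀ {A : Set} {xs : List A} → Unique xs →
                   ∀ i j → lookup xs i ≡ lookup xs j → i ≡ j
lookup-injective (_  ∷ _)   Fin.zero    Fin.zero    _  = refl
lookup-injective (x∉ ∷ _)   Fin.zero    (Fin.suc j) eq = contradiction eq (All.lookup x∉ (∈-lookup j))
lookup-injective (x∉ ∷ _)   (Fin.suc i) Fin.zero    eq = contradiction (sym eq) (All.lookup x∉ (∈-lookup i))
lookup-injective (_  ∷ xs!) (Fin.suc i) (Fin.suc j) eq = cong Fin.suc (lookup-injective xs! i j eq)

injectiveOn⇒length≤ : ∀ {A B : Set} {xs : List A} {ys : List B} → Unique xs →
  (h : A → B) → (∀ {x} → x ∈ xs → h x ∈ ys) →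
  (∀ {x y} → x ∈ xs → y ∈ xs → h x ≡ h y → x ≡ y) → length xs ≤ length ys
injectiveOn⇒length≤ {xs = xs} {ys} xs! h h∈ys h-inj = injective⇒≤ {f = position} position-injective
  where
  position : Fin (length xs) → Fin (length ys)
  position i = index (h∈ys (∈-lookup i))

  position-injective : ∀ {i j} → position i ≡ position j → i ≡ j
  position-injective {i} {j} eq = lookup-injective xs! i j (h-inj (∈-lookup i) (∈-lookup j) (begin
    h (lookup xs i)          ≡⟨ lookup-index (h∈ys (∈-lookup i)) ⟩
    lookup ys (position i)   ≡⟨ cong (lookup ys) eq ⟩
    lookup ys (position j)   ≡⟨ lookup-index (h∈ys (∈-lookup j)) ⟨
    h (lookup xs j)          ∎))
    where open ≡-Reasoning

Unique⇒length≤ : ∀ {n} {xs : List (Fin n)} → Unique xs → length xs ≤ n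
Unique⇒length≤ {n} xs! = ℕ.≤-trans
  (injectiveOn⇒length≤ xs! (λ x → x) (λ {x} _ → ∈-allFin x) (λ _ _ eq → eq))
  (ℕ.≤-reflexive (length-tabulate (λ x → x)))

module _ {n : ℕ} {R : Fin n → Fin n → Set} where

  vertices : ∀ {u v} → Star R u v → List (Fin n)
  vertices {v = v} ε       = v ∷ []
  vertices {u = u} (_ ◅ p) = u ∷ vertices p

  suffixFrom : ∀ {x u v} (p : Star R u v) → x ∈ vertices p → Unique (vertices p) →
               Σ (Star R x v) (Unique ∘ vertices)
  suffixFrom ε       (here refl) p! = ε , p!
  suffixFrom (r ◅ p) (here refl) p! = r ◅ p , p!
  suffixFrom (_ ◅ p) (there x∈p) (_ ∷ p!) = suffixFrom p x∈p p!

  eraseLoops : ∀ {u v} → Star R u v → Σ (Star R u v) (Unique ∘ vertices)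
  eraseLoops ε = ε , All.[] ∷ []
  eraseLoops {u} (r ◅ p) with eraseLoops p
  ... | q , q! with any? (u ≟F_) (vertices q)
  ...   | yes u∈q = suffixFrom q u∈q q!
  ...   | no  u∉q = r ◅ q , ¬Any⇒All¬ _ u∉q ∷ q!

  shortWalk : ∀ {u v} → Star R u v → Σ (Star R u v) λ q → length (vertices q) ≤ n
  shortWalk p = let q , q! = eraseLoops p in q , Unique⇒length≤ q!

module Connectivity {n : ℕ} (hs : List (Subset n)) where

  Adjacent : Fin n → Fin n → Set
  Adjacent u w = T (adjacent hs u w)

  Walk : Fin n → Fin n → Set
  Walk = Star Adjacent

  adjacent-sym : ∀ {u w} → Adjacent u w → Adjacent w u
  adjacent-sym {u} {w} =
    any⁺ _ ∘ Any.map (λ {h} → subst T (∧-comm (Vec.lookup h u) (Vec.lookup h w))) ∘ any⁻ _ hs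

  reverseWalk : ∀ {u v} → Walk u v → Walk v u
  reverseWalk = Star.reverse adjacent-sym

  reach-suc : ∀ {k u v} → T (reach hs k u v) → T (reach hs (suc k) u v)
  reach-suc r = from T-∨ (inj₁ r)

  reach-mono : ∀ {k k′ u v} → k ≤′ k′ → T (reach hs k u v) → T (reach hs k′ u v)
  reach-mono ≤′-refl       r = r
  reach-mono (≤′-step {n = k′} k≤k′) r = reach-suc {k′} (reach-mono k≤k′ r)

  reach⇒Walk : ∀ k {u v} → T (reach hs k u v) → Walk u v
  reach⇒Walk zero r with toWitness r
  ... | refl = ε
  reach⇒Walk (suc k) {u} {v} r with to T-∨ r
  ... | inj₁ r′ = reach⇒Walk k r′
  ... | inj₂ r′ with find (any⁻ _ (allFin n) r′)
  ...   | w , _ , u∼w∧r with to T-∧ u∼w∧r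
  ...     | u∼w , w⇝v = u∼w ◅ reach⇒Walk k w⇝v

  Walk⇒reach : ∀ {u v} (p : Walk u v) → T (reach hs (length (vertices p)) u v)
  Walk⇒reach {u} ε                 = reach-suc {0} (fromWitness {a? = u ≟F u} refl)
  Walk⇒reach (_◅_ {j = w} u∼w p) =
    from T-∨ (inj₂ (any⁺ _ (lose (∈-allFin w) (from T-∧ (u∼w , Walk⇒reach p)))))

  connectedB⇒Walk : ∀ {u v} → T (connectedB hs u v) → Walk u v
  connectedB⇒Walk = reach⇒Walk n

  Walk⇒connectedB : ∀ {u v} → Walk u v → T (connectedB hs u v)
  Walk⇒connectedB p with shortWalk p
  ... | q , |q|≤n = reach-mono {length (vertices q)} (ℕ.≤⇒≤′ |q|≤n) (Walk⇒reach q)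

  hasSmallerLinked : Fin n → Bool
  hasSmallerLinked v = any (λ w → ⌊ w <? v ⌋ ∧ connectedB hs w v) (allFin n)

  isRoot : Fin n → Bool
  isRoot v = not (hasSmallerLinked v)

  roots : List (Fin n)
  roots = filter (λ v → isRoot v ≟B true) (allFin n)

  root-least : ∀ {r w} → isRoot r ≡ true → w < r → ¬ Walk w r
  root-least {r} {w} r-root w<r w⇝r = subst T (to T-not-≡ (from T-≡ r-root))
    (any⁺ _ (lose (∈-allFin w) (from T-∧ (fromWitness w<r , Walk⇒connectedB w⇝r))))

  rootBelow : ∀ v → Acc _<_ v → ∃ λ r → isRoot r ≡ true × Walk r v
  rootBelow v (acc smaller) with hasSmallerLinked v in eq
  ... | false = v , cong not eq , ε
  ... | true with find (any⁻ _ (allFin n) (from T-≡ eq))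
  ...   | w , _ , w<v∧w⇝v with to T-∧ w<v∧w⇝v
  ...     | w<v , w⇝v with rootBelow w (smaller (toWitness w<v))
  ...       | r , r-root , r⇝w = r , r-root , r⇝w ◅◅ connectedB⇒Walk w⇝v

  root : Fin n → Fin n
  root v = proj₁ (rootBelow v (<-wellFounded v))

  root-isRoot : ∀ v → isRoot (root v) ≡ true
  root-isRoot v = proj₁ (proj₂ (rootBelow v (<-wellFounded v)))

  root-walk : ∀ v → Walk (root v) v
  root-walk v = proj₂ (proj₂ (rootBelow v (<-wellFounded v)))

  roots-linked⇒≡ : ∀ {r r′} → isRoot r ≡ true → isRoot r′ ≡ true → Walk r r′ → r ≡ r′
  roots-linked⇒≡ {r} {r′} r-root r′-root r⇝r′ with <-cmp r r′
  ... | tri< r<r′ _ _ = contradiction r⇝r′ (root-least r′-root r<r′)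
  ... | tri≈ _ r≡r′ _ = r≡r′
  ... | tri> _ _ r′<r = contradiction (reverseWalk r⇝r′) (root-least r-root r′<r)

  root-of-root : ∀ {r} → isRoot r ≡ true → root r ≡ r
  root-of-root r-root = roots-linked⇒≡ (root-isRoot _) r-root (root-walk _)

  sameRoot⇒Walk : ∀ {x y} → root x ≡ root y → Walk x y
  sameRoot⇒Walk {x} {y} eq = reverseWalk (root-walk x) ◅◅ subst (λ r → Walk r y) (sym eq) (root-walk y)

  root∈roots : ∀ {r} → isRoot r ≡ true → r ∈ roots
  root∈roots {r} = ∈-filter⁺ (λ v → isRoot v ≟B true) (∈-allFin r)

  ∈roots⇒isRoot : ∀ {r} → r ∈ roots → isRoot r ≡ true
  ∈roots⇒isRoot = proj₂ ∘ ∈-filter⁻ (λ v → isRoot v ≟B true) {xs = allFin n}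

  roots-unique : Unique roots
  roots-unique = Unique.filter⁺ (λ v → isRoot v ≟B true) (Unique.allFin⁺ n)

  numComps≤n : numComps n hs ≤ n
  numComps≤n = Unique⇒length≤ roots-unique

  componentOf : Fin n → Fin (numComps n hs)
  componentOf v = index (root∈roots (root-isRoot v))

  root≡lookup-componentOf : ∀ v → root v ≡ lookup roots (componentOf v)
  root≡lookup-componentOf v = lookup-index (root∈roots (root-isRoot v))

  componentOf-surjective : Surjective _≡_ _≡_ componentOf
  componentOf-surjective j = r , λ { refl → lookup-injective roots-unique _ _ (begin
      lookup roots (componentOf r) ≡⟨ root≡lookup-componentOf r ⟨
      root r                       ≡⟨ root-of-root (∈roots⇒isRoot (∈-lookup j)) ⟩
      r                            ∎) }
    where
    r : Fin n
    r = lookup roots j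
    open ≡-Reasoning

  componentPartition : Partition n
  componentPartition = record { k = numComps n hs ; part = componentOf ; onto = componentOf-surjective }

  sameComponent⇒Walk : ∀ {x y} → componentOf x ≡ componentOf y → Walk x y
  sameComponent⇒Walk {x} {y} eq = sameRoot⇒Walk (begin
    root x                       ≡⟨ root≡lookup-componentOf x ⟩
    lookup roots (componentOf x) ≡⟨ cong (lookup roots) eq ⟩
    lookup roots (componentOf y) ≡⟨ root≡lookup-componentOf y ⟨
    root y                       ∎)
    where open ≡-Reasoning

module _ {n k : ℕ} {hs : List (Subset n)} {hs′ : List (Subset k)} where
  private
    module C  = Connectivity hs
    module C′ = Connectivity hs′

  numComps≤-of-reflecting : (φ : Fin n → Fin k) → (∀ {x y} → C′.Walk (φ x) (φ y) → C.Walk x y) →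
                            numComps n hs ≤ numComps k hs′
  numComps≤-of-reflecting φ reflects =
    injectiveOn⇒length≤ C.roots-unique (C′.root ∘ φ) (λ _ → C′.root∈roots (C′.root-isRoot _)) injective
    where
    injective : ∀ {x y} → x ∈ C.roots → y ∈ C.roots → C′.root (φ x) ≡ C′.root (φ y) → x ≡ y
    injective {x} {y} x∈ y∈ eq = C.roots-linked⇒≡ (C.∈roots⇒isRoot x∈) (C.∈roots⇒isRoot y∈)
      (reflects (C′.sameRoot⇒Walk eq))

open Connectivity using (Adjacent; Walk)

Walk-mono : ∀ {n} {hs hs′ : List (Subset n)} → hs ⊆ᴸ hs′ → ∀ {u v} → Walk hs u v → Walk hs′ u v
Walk-mono hs⊆hs′ = Star.map (any⁺ _ ∘ Any-resp-⊆ hs⊆hs′ ∘ any⁻ _ _)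

module _ {n k : ℕ} (p : Fin n → Fin k) where

  ∈-contractEdge⁻ : ∀ {h j} → T (Vec.lookup (contractEdge p h) j) → ∃ λ i → T (Vec.lookup h i) × p i ≡ j
  ∈-contractEdge⁻ {h} {j} j∈ rewrite lookup∘tabulate (λ j → any (λ i → Vec.lookup h i ∧ ⌊ p i ≟F j ⌋) (allFin n)) j
    with find (any⁻ _ (allFin n) j∈)
  ... | i , _ , i∈h∧pi≡j with to T-∧ i∈h∧pi≡j
  ...   | i∈h , pi≡j = i , i∈h , toWitness pi≡j

  Adjacent-contract⁻ : ∀ {es j j′} → Adjacent (map (contractEdge p) es) j j′ →
                       ∃₂ λ i i′ → p i ≡ j × p i′ ≡ j′ × Adjacent es i i′
  Adjacent-contract⁻ {es} j∼j′ with find (any⁻ _ (map (contractEdge p) es) j∼j′)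
  ... | _ , h′∈ , j∈h′∧j′∈h′ with ∈-map⁻ (contractEdge p) h′∈
  ...   | h , h∈es , refl with to T-∧ j∈h′∧j′∈h′
  ...     | j∈ , j′∈ with ∈-contractEdge⁻ {h} j∈ | ∈-contractEdge⁻ {h} j′∈
  ...       | i , i∈h , pi≡j | i′ , i′∈h , pi′≡j′ =
    i , i′ , pi≡j , pi′≡j′ , any⁺ (λ h → Vec.lookup h i ∧ Vec.lookup h i′) (lose h∈es (from T-∧ (i∈h , i′∈h)))

  -- A walk in the contraction lifts by walking inside parts between consecutive hyperedges.
  Walk-contract⁻ : ∀ {hs es hs′ : List (Subset n)} → hs ⊆ᴸ hs′ → es ⊆ᴸ hs′ →
    (∀ {x y} → p x ≡ p y → Walk hs x y) →
    ∀ {x y} → Walk (map (contractEdge p) es) (p x) (p y) → Walk hs′ x y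
  Walk-contract⁻ {hs} {es} {hs′} hs⊆ es⊆ insidePart = lift refl refl
    where
    lift : ∀ {j j′ x y} → p x ≡ j → p y ≡ j′ → Walk (map (contractEdge p) es) j j′ → Walk hs′ x y
    lift px≡j py≡j′ ε = Walk-mono hs⊆ (insidePart (trans px≡j (sym py≡j′)))
    lift px≡j py≡j′ (j∼ ◅ w) with Adjacent-contract⁻ {es} j∼
    ... | i , i′ , pi≡j , pi′ , i∼i′ =
      Walk-mono hs⊆ (insidePart (trans px≡j (sym pi≡j)))
        ◅◅ Walk-mono es⊆ (i∼i′ ◅ ε) ◅◅ lift pi′ py≡j′ w

[o∸m]∸[o∸n]≡n∸m : ∀ o m n → n ≤ o → (o ∸ m) ∸ (o ∸ n) ≡ n ∸ m
[o∸m]∸[o∸n]≡n∸m o       zero    n       n≤o       = ℕ.m∸[m∸n]≡n n≤o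
[o∸m]∸[o∸n]≡n∸m zero    (suc m) zero    z≤n       = refl
[o∸m]∸[o∸n]≡n∸m (suc o) (suc m) zero    z≤n       = ℕ.m≤n⇒m∸n≡0 (ℕ.≤-trans (ℕ.m∸n≤m o m) (ℕ.n≤1+n o))
[o∸m]∸[o∸n]≡n∸m (suc o) (suc m) (suc n) (s≤s n≤o) = [o∸m]∸[o∸n]≡n∸m o m n n≤o

sum-map-mono : ∀ {A : Set} {g h : A → ℕ} → (∀ x → g x ≤ h x) → ∀ xs → sum (map g xs) ≤ sum (map h xs)
sum-map-mono g≤h []       = z≤n
sum-map-mono g≤h (x ∷ xs) = ℕ.+-mono-≤ (g≤h x) (sum-map-mono g≤h xs)

floorDiv-monoˡ : ∀ {a a′} d → a ≤ a′ → floorDiv a d ≤∞ floorDiv a′ d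
floorDiv-monoˡ zero    _     = ∞ ≤∞∞
floorDiv-monoˡ (suc d) a≤a′ = fin≤fin (/-monoˡ-≤ (suc d) a≤a′)

≤∞-trans : ∀ {x y z} → x ≤∞ y → y ≤∞ z → x ≤∞ z
≤∞-trans (fin≤fin x≤y) (fin≤fin y≤z) = fin≤fin (ℕ.≤-trans x≤y y≤z)
≤∞-trans _             (_ ≤∞∞)       = _ ≤∞∞

module _ (G : Hedgegraph) where
  open Hedgegraph G

  private
    inSubset? : (B : Subset m) → ∀ a → Dec (Vec.lookup B a ≡ true)
    inSubset? B a = Vec.lookup B a ≟B true

  ∈-hyperedgesOf⁺ : ∀ {B a h} → a ∈ₛ B → h ∈ hedge a → h ∈ hyperedgesOf G B
  ∈-hyperedgesOf⁺ {B} {a} a∈B h∈a =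
    ∈-concatMap⁺ hedge (lose (∈-filter⁺ (inSubset? B) (∈-allFin a) ([]=⇒lookup a∈B)) h∈a)

  hyperedgesOf-mono : ∀ {B C} → B ⊆ₛ C → hyperedgesOf G B ⊆ᴸ hyperedgesOf G C
  hyperedgesOf-mono {B} B⊆C h∈ with find (∈-concatMap⁻ hedge {xs = filter (inSubset? B) (allFin m)} h∈)
  ... | a , a∈ , h∈a =
    ∈-hyperedgesOf⁺ (B⊆C (lookup⇒[]= a B (proj₂ (∈-filter⁻ (inSubset? B) {xs = allFin m} a∈)))) h∈a

  #Comps-∪⁅⁆≤#CompsContr : ∀ A e →
    #Comps G (A ∪ ⁅ e ⁆) ≤ #CompsContr G (Connectivity.componentPartition (hyperedgesOf G A)) e
  #Comps-∪⁅⁆≤#CompsContr A e =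
    numComps≤-of-reflecting {hs = hyperedgesOf G (A ∪ ⁅ e ⁆)} {hs′ = map (contractEdge componentOf) (hedge e)}
    componentOf
    (Walk-contract⁻ componentOf {hs = hyperedgesOf G A} {es = hedge e} {hs′ = hyperedgesOf G (A ∪ ⁅ e ⁆)}
                                (hyperedgesOf-mono {A} {A ∪ ⁅ e ⁆} (p⊆p∪q ⁅ e ⁆))
                                (∈-hyperedgesOf⁺ {A ∪ ⁅ e ⁆} (x∈p∪q⁺ {p = A} (inj₂ (x∈⁅x⁆ e))))
                                sameComponent⇒Walk)
    where open Connectivity (hyperedgesOf G A)

  f∸f≡#Comps∸#Comps : ∀ B C → f G B ∸ f G C ≡ #Comps G C ∸ #Comps G B
  f∸f≡#Comps∸#Comps B C =
    [o∸m]∸[o∸n]≡n∸m n (#Comps G B) (#Comps G C) (Connectivity.numComps≤n (hyperedgesOf G C))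

  wpcValue-components≤kValue : Connected G → ∀ A →
    wpcValue G (Connectivity.componentPartition (hyperedgesOf G A)) ≤∞ kValue G A
  wpcValue-components≤kValue connected A =
    subst (wpcValue G P ≤∞_) (cong (floorDiv gains) (sym denominator))
          (floorDiv-monoˡ (#Comps G A ∸ 1) (sum-map-mono numerator (allFin m)))
    where
    P : Partition n
    P = Connectivity.componentPartition (hyperedgesOf G A)

    gains : ℕ
    gains = sum (map (λ e → f G (A ∪ ⁅ e ⁆) ∸ f G A) (allFin m))

    denominator : f G ⊤ ∸ f G A ≡ #Comps G A ∸ 1
    denominator = trans (f∸f≡#Comps∸#Comps ⊤ A) (cong (#Comps G A ∸_) connected)

    numerator : ∀ e → #Comps G A ∸ #CompsContr G P e ≤ f G (A ∪ ⁅ e ⁆) ∸ f G A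
    numerator e = subst (#Comps G A ∸ #CompsContr G P e ≤_) (sym (f∸f≡#Comps∸#Comps (A ∪ ⁅ e ⁆) A))
                        (ℕ.∸-monoʳ-≤ (#Comps G A) (#Comps-∪⁅⁆≤#CompsContr A e))

lemma4p2 : (G : Hedgegraph) → Connected G →
    (w s : ℕ∞) → IsWPC G w → IsFunctionalStrength G s → w ≤∞ s
lemma4p2 G connected w s (_ , w-least) ((A , refl) , _) =
  ≤∞-trans (w-least (Connectivity.componentPartition (hyperedgesOf G A)))
           (wpcValue-components≤kValue G connected A)
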